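{- For integers $m\ge 3$ and $n\ge 7$, \[ \left\lceil\frac{n+1}{3}\right\rceil(m+2)-2\;\le\;\gamma^{\mathrm{SID}}(K_m\times P_n)\;\le\;\left\lceil\frac{n+1}{3}\right\rceil(m+3)+m. \]
   Context: For a vertex $v$, $N[v]$ is its closed neighborhood. A nonempty set $S\subseteq V(G)$ is a self-identifying code of $G$ if for every vertex $v\in V(G)$: (1) $N[v]\cap S\neq\emptyset$, and (2) $\bigcap_{c\in N[v]\cap S}N[c]=\{v\}$; $\gamma^{\mathrm{SID}}(G)$ is the minimum size of such a code. With $V(K_m)=\{v_0,\dots,v_{m-1}\}$ and $V(P_n)=\{0,\dots,n-1\}$ (consecutively numbered path), the direct product $K_m\times P_n$ has vertices $(v_i,j)$, with $(v_i,j)$ adjacent to $(v_{i'},j')$ iff $i\neq i'$ and $|j-j'|=1$. -}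

module Defs where

open import Data.Nat using (ℕ; zero; suc; _+_; _*_; _≤_; _/_)
open import Data.Fin using (Fin; toℕ)
open import Data.Fin.Properties using ()
open import Data.Bool using (Bool; true; false; if_then_else_)
open import Data.Product using (_×_; _,_; Σ; ∃)
open import Data.Sum using (_⊎_)
open import Data.List using (List; map; allFin; cartesianProduct)
open import Data.Nat.ListAction using (sum)
open import Relation.Binary.PropositionalEquality using (_≡_; _≢_)
open import Relation.Nullary using (¬_)

record Graph : Set₁ where
  field
    V    : Set
    Adj  : V → V → Set
    -- enumeration of the (finitely many) vertices, each listed exactly once
    vertices : List V

open Graph public

_∈N[_] : {G : Graph} → V G → V G → Set
_∈N[_] {G} w v = w ≡ v ⊎ Adj G v w

Subset : Graph → Set
Subset G = V G → Bool

card : (G : Graph) → Subset G → ℕ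
card G S = sum (map (λ v → if S v then 1 else 0) (vertices G))

IsSIDCode : (G : Graph) → Subset G → Set
IsSIDCode G S =
  (∃ λ c → S c ≡ true) ×
  (∀ (v : V G) → ∃ λ c → S c ≡ true × _∈N[_] {G} c v) ×
  -- (2) ⋂_{c ∈ N[v] ∩ S} N[c] = {v}
  (∀ (v w : V G) →
     ((∀ c → S c ≡ true → _∈N[_] {G} c v → _∈N[_] {G} w c) → w ≡ v) ×
     (w ≡ v → ∀ c → S c ≡ true → _∈N[_] {G} c v → _∈N[_] {G} w c))

IsSIDNumber : Graph → ℕ → Set
IsSIDNumber G k =
  (Σ (Subset G) λ S → IsSIDCode G S × card G S ≡ k) ×
  (∀ S → IsSIDCode G S → k ≤ card G S)

KmxPn-Adj : (m n : ℕ) → Fin m × Fin n → Fin m × Fin n → Set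
KmxPn-Adj m n (i , j) (i' , j') =
  i ≢ i' × (suc (toℕ j) ≡ toℕ j' ⊎ suc (toℕ j') ≡ toℕ j)

KmxPn : ℕ → ℕ → Graph
KmxPn m n = record
  { V = Fin m × Fin n
  ; Adj = KmxPn-Adj m n
  ; vertices = cartesianProduct (allFin m) (allFin n)
  }

ceil3 : ℕ → ℕ
ceil3 a = (a + 2) / 3

-- In a self-identifying code of K_m × P_n, view three consecutive columns x, y, z as sets of
-- rows.  A vertex of the middle column must be separated from the other vertices of its column
-- and from those at column distance one and two; this constrains x, y, z (Window), and a case
-- analysis on the rows missing from y gives |x| + |y| + |z| ≥ m + 2 away from the ends.  The two
-- end columns are full and their neighbours have at least three vertices, so summing over
-- consecutive blocks of three columns gives the lower bound.  For the upper bound, the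
-- construction repeats a column pattern of period six with m + 3 vertices in any three
-- consecutive columns, and a local Certificate at every vertex shows that it is a code.  Codes
-- of a finite graph can be enumerated, so a smallest one exists and lies between the bounds.

module Submission where

open import Defs
import Algebra.Properties.CommutativeMonoid.Sum as ∑
open import Data.Bool using (Bool; true; false; not; if_then_else_)
import Data.Bool.Properties as Bool
open import Data.Empty using (⊥; ⊥-elim)
open import Data.Fin using (Fin; zero; suc; toℕ; fromℕ<; combine; remQuot)
import Data.Fin.Properties as Fin
import Data.Fin.Subset
open import Data.Fin.Subset.Properties using (anySubset?)
open import Data.List using (List; _++_; map; tabulate; allFin; cartesianProduct)
import Data.List.Properties as List
import Data.Nat.ListAction as List
open import Data.Nat.ListAction.Properties using (sum-++)
open import Data.Nat using (ℕ; zero; suc; _+_; _*_; _∸_; _≤_; _<_; _≤?_; z≤n; s≤s; s≤s⁻¹)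
open import Data.Nat.Properties
open import Data.Nat.DivMod using (m/n≡1+[m∸n]/n)
open import Data.Nat.Tactic.RingSolver using (solve-∀)
open import Algebra.Properties.CommutativeSemigroup +-commutativeSemigroup using (x∙yz≈y∙xz)
open import Data.Product using (_×_; _,_; ∃; ∃₂; proj₁; proj₂)
open import Data.Product.Properties using (≡-dec)
open import Data.Sum using (_⊎_; inj₁; inj₂; [_,_]′)
open import Data.Vec using (lookup) renaming (tabulate to tabulateᵛ)
open import Data.Vec.Properties using (lookup∘tabulate)
open import Function using (_∘_)
open import Relation.Nullary using (¬_; Dec; yes; no; does)
import Relation.Nullary.Decidable
open Relation.Nullary.Decidable using (_×-dec_; _⊎-dec_; _→-dec_; ¬?)
open import Relation.Binary.PropositionalEquality

open ∑ +-0-commutativeMonoid using (sum; sum-cong-≗; ∑-distrib-+; ∑-comm)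

∑-mono : ∀ {k} {f g : Fin k → ℕ} → (∀ i → f i ≤ g i) → sum f ≤ sum g
∑-mono {zero}  f≤g = z≤n
∑-mono {suc k} f≤g = +-mono-≤ (f≤g zero) (∑-mono (f≤g ∘ suc))

∑-const : ∀ k c → sum {k} (λ _ → c) ≡ k * c
∑-const zero    c = refl
∑-const (suc k) c = cong (c +_) (∑-const k c)

ind : Bool → ℕ
ind b = if b then 1 else 0

count : ∀ {m} → (Fin m → Bool) → ℕ
count x = sum (ind ∘ x)

δ : ∀ {m} → Fin m → Fin m → ℕ
δ a k = ind (does (k Fin.≟ a))

∑-zeros : ∀ k → sum {k} (λ _ → 0) ≡ 0
∑-zeros k = trans (∑-const k 0) (*-zeroʳ k)

∑-ones : ∀ k → sum {k} (λ _ → 1) ≡ k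
∑-ones k = trans (∑-const k 1) (*-identityʳ k)

∑-δ : ∀ {m} (a : Fin m) → sum (δ a) ≡ 1
∑-δ {suc m} zero    = cong suc (∑-zeros m)
∑-δ {suc m} (suc a) = ∑-δ a

count-cong : ∀ {m} {x y : Fin m → Bool} → x ≗ y → count x ≡ count y
count-cong x≗y = sum-cong-≗ (cong ind ∘ x≗y)

module _ {m : ℕ} (x : Fin m → Bool) where

  count≤ : count x ≤ m
  count≤ = subst (count x ≤_) (∑-ones m) (∑-mono λ k → ind≤1 (x k))
    where
    ind≤1 : ∀ b → ind b ≤ 1
    ind≤1 true  = ≤-refl
    ind≤1 false = z≤n

  count-full : (∀ k → x k ≡ true) → count x ≡ m
  count-full full = trans (sum-cong-≗ (cong ind ∘ full)) (∑-ones m)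

  1≤count : ∀ {a} → x a ≡ true → 1 ≤ count x
  1≤count {a} xa = subst (_≤ count x) (∑-δ a) (∑-mono pointwise)
    where
    pointwise : ∀ k → δ a k ≤ ind (x k)
    pointwise k with k Fin.≟ a
    ... | yes refl = ≤-reflexive (cong ind (sym xa))
    ... | no _     = z≤n

  2≤count : ∀ {a b} → x a ≡ true → x b ≡ true → a ≢ b → 2 ≤ count x
  2≤count {a} {b} xa xb a≢b =
    subst (_≤ count x) (trans (∑-distrib-+ (δ a) (δ b)) (cong₂ _+_ (∑-δ a) (∑-δ b))) (∑-mono pointwise)
    where
    pointwise : ∀ k → δ a k + δ b k ≤ ind (x k)
    pointwise k with k Fin.≟ a | k Fin.≟ b
    ... | yes refl | yes refl = ⊥-elim (a≢b refl)
    ... | yes refl | no _     = ≤-reflexive (cong ind (sym xa))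
    ... | no _     | yes refl = ≤-reflexive (cong ind (sym xb))
    ... | no _     | no _     = z≤n

  3≤count : ∀ {a b c} → x a ≡ true → x b ≡ true → x c ≡ true → a ≢ b → a ≢ c → b ≢ c → 3 ≤ count x
  3≤count {a} {b} {c} xa xb xc a≢b a≢c b≢c = subst (_≤ count x) ∑δ+δ+δ≡3 (∑-mono pointwise)
    where
    ∑δ+δ+δ≡3 : sum (λ k → δ a k + (δ b k + δ c k)) ≡ 3
    ∑δ+δ+δ≡3 = begin
      sum (λ k → δ a k + (δ b k + δ c k))  ≡⟨ ∑-distrib-+ (δ a) _ ⟩
      sum (δ a) + sum (λ k → δ b k + δ c k) ≡⟨ cong (sum (δ a) +_) (∑-distrib-+ (δ b) (δ c)) ⟩
      sum (δ a) + (sum (δ b) + sum (δ c))   ≡⟨ cong₂ _+_ (∑-δ a) (cong₂ _+_ (∑-δ b) (∑-δ c)) ⟩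
      3                                     ∎
      where open ≡-Reasoning
    pointwise : ∀ k → δ a k + (δ b k + δ c k) ≤ ind (x k)
    pointwise k with k Fin.≟ a | k Fin.≟ b | k Fin.≟ c
    ... | yes refl | yes refl | _        = ⊥-elim (a≢b refl)
    ... | yes refl | _        | yes refl = ⊥-elim (a≢c refl)
    ... | _        | yes refl | yes refl = ⊥-elim (b≢c refl)
    ... | yes refl | no _     | no _     = ≤-reflexive (cong ind (sym xa))
    ... | no _     | yes refl | no _     = ≤-reflexive (cong ind (sym xb))
    ... | no _     | no _     | yes refl = ≤-reflexive (cong ind (sym xc))
    ... | no _     | no _     | no _     = z≤n

  count-all-but-one : ∀ i → (∀ k → k ≢ i → x k ≡ true) → m ≤ suc (count x)
  count-all-but-one i almost-full =
    subst₂ _≤_ (∑-ones m) (trans (∑-distrib-+ (ind ∘ x) (δ i)) (trans (cong (count x +_) (∑-δ i)) (+-comm (count x) 1)))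
      (∑-mono pointwise)
    where
    pointwise : ∀ k → 1 ≤ ind (x k) + δ i k
    pointwise k with k Fin.≟ i
    ... | yes refl = m≤n+m 1 (ind (x k))
    ... | no k≢i   = ≤-reflexive (cong (λ b → ind b + 0) (sym (almost-full k k≢i)))

module _ {m : ℕ} (x z : Fin m → Bool) where

  private
    1≤ind∨ind : ∀ k → x k ≡ true ⊎ z k ≡ true → 1 ≤ ind (x k) + ind (z k)
    1≤ind∨ind k (inj₁ xk) rewrite xk = s≤s z≤n
    1≤ind∨ind k (inj₂ zk) rewrite zk = m≤n+m 1 (ind (x k))

  count-cover : (∀ k → x k ≡ true ⊎ z k ≡ true) → m ≤ count x + count z
  count-cover cover = subst₂ _≤_ (∑-ones m) (∑-distrib-+ (ind ∘ x) (ind ∘ z)) (∑-mono λ k → 1≤ind∨ind k (cover k))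

  count-cover-twice : ∀ a → (∀ k → x k ≡ true ⊎ z k ≡ true) → x a ≡ true → z a ≡ true → suc m ≤ count x + count z
  count-cover-twice a cover xa za =
    subst₂ _≤_ (trans (∑-distrib-+ (λ _ → 1) (δ a)) (trans (cong₂ _+_ (∑-ones m) (∑-δ a)) (+-comm m 1)))
      (∑-distrib-+ (ind ∘ x) (ind ∘ z)) (∑-mono pointwise)
    where
    pointwise : ∀ k → 1 + δ a k ≤ ind (x k) + ind (z k)
    pointwise k with k Fin.≟ a
    ... | yes refl rewrite xa | za = ≤-refl
    ... | no _     = 1≤ind∨ind k (cover k)

witness : ∀ {m} (x : Fin m → Bool) {C : Fin m → Set} → (∀ k → Dec (C k)) →
  ¬ (∀ k → C k → x k ≡ false) → ∃ λ k → C k × x k ≡ true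
witness x C? none with Fin.any? (λ k → C? k ×-dec (x k Bool.≟ true))
... | yes found = found
... | no ¬found = ⊥-elim (none λ k ck → Bool.¬-not λ xk → ¬found (k , ck , xk))

avoid-two : ∀ {m} (a b : Fin (3 + m)) → ∃ λ k → k ≢ a × k ≢ b
avoid-two a b with zero Fin.≟ a | zero Fin.≟ b
... | no 0≢a   | no 0≢b = zero , 0≢a , 0≢b
... | yes refl | _ with suc zero Fin.≟ b
...   | no 1≢b   = suc zero , (λ ()) , 1≢b
...   | yes refl = suc (suc zero) , (λ ()) , (λ ())
avoid-two a b | no _ | yes refl with suc zero Fin.≟ a
...   | no 1≢a   = suc zero , 1≢a , (λ ())
...   | yes refl = suc (suc zero) , (λ ()) , (λ ())

avoid-one : ∀ {m} (a : Fin (3 + m)) → ∃ λ k → k ≢ a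
avoid-one a = let k , k≢a , _ = avoid-two a a in k , k≢a

column : ∀ {m n} → (Fin m × Fin n → Bool) → Fin n → Fin m → Bool
column S j i = S (i , j)

List-sum-tabulate : ∀ {A : Set} {k} (g : A → ℕ) (h : Fin k → A) → List.sum (map g (tabulate h)) ≡ sum (g ∘ h)
List-sum-tabulate {k = zero}  g h = refl
List-sum-tabulate {k = suc k} g h = cong (g (h zero) +_) (List-sum-tabulate g (h ∘ suc))

List-sum-cartesianProduct : ∀ {A B : Set} {k} (g : A × B → ℕ) (h : Fin k → A) (ys : List B) →
  List.sum (map g (cartesianProduct (tabulate h) ys)) ≡ sum (λ i → List.sum (map (λ y → g (h i , y)) ys))
List-sum-cartesianProduct {k = zero}  g h ys = refl
List-sum-cartesianProduct {k = suc k} g h ys = begin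
  List.sum (map g (map (h zero ,_) ys ++ cartesianProduct (tabulate (h ∘ suc)) ys))
    ≡⟨ cong List.sum (List.map-++ g (map (h zero ,_) ys) _) ⟩
  List.sum (map g (map (h zero ,_) ys) ++ map g (cartesianProduct (tabulate (h ∘ suc)) ys))
    ≡⟨ sum-++ (map g (map (h zero ,_) ys)) _ ⟩
  List.sum (map g (map (h zero ,_) ys)) + List.sum (map g (cartesianProduct (tabulate (h ∘ suc)) ys))
    ≡⟨ cong₂ _+_ (cong List.sum (sym (List.map-∘ ys))) (List-sum-cartesianProduct g (h ∘ suc) ys) ⟩
  List.sum (map (λ y → g (h zero , y)) ys) + sum (λ i → List.sum (map (λ y → g (h (suc i) , y)) ys))
    ∎
  where open ≡-Reasoning

card-by-columns : ∀ m n (S : Fin m × Fin n → Bool) → card (KmxPn m n) S ≡ sum (count ∘ column S)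
card-by-columns m n S = begin
  card (KmxPn m n) S                       ≡⟨ List-sum-cartesianProduct (ind ∘ S) (λ i → i) (allFin n) ⟩
  sum (λ i → List.sum (map (λ j → ind (S (i , j))) (allFin n)))
                                           ≡⟨ sum-cong-≗ (λ i → List-sum-tabulate (λ j → ind (S (i , j))) (λ j → j)) ⟩
  sum (λ i → sum (λ j → ind (S (i , j)))) ≡⟨ ∑-comm (λ i j → ind (S (i , j))) ⟩
  sum (count ∘ column S)                   ∎
  where open ≡-Reasoning

-- Existence of a smallest code

least-witness : (P : ℕ → Set) → (∀ k → Dec (P k)) → ∀ K → P K → ∃ λ k → P k × (∀ j → P j → k ≤ j)
least-witness P P? K pK = search 0 K refl (λ _ ())
  where
  search : ∀ i d → i + d ≡ K → (∀ j → j < i → ¬ P j) → ∃ λ k → P k × (∀ j → P j → k ≤ j)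
  search i d i+d≡K below with P? i
  ... | yes pi = i , pi , λ j pj → ≮⇒≥ (λ j<i → below j j<i pj)
  search i zero    i+0≡K below | no ¬pi = ⊥-elim (¬pi (subst P (trans (sym i+0≡K) (+-identityʳ i)) pK))
  search i (suc d) i+d≡K below | no ¬pi = search (suc i) d (trans (sym (+-suc i d)) i+d≡K) below′
    where
    below′ : ∀ j → j < suc i → ¬ P j
    below′ j j<1+i with m≤n⇒m<n∨m≡n (s≤s⁻¹ j<1+i)
    ... | inj₁ j<i  = below j j<i
    ... | inj₂ refl = ¬pi

module _ (G : Graph) {S T : Subset G} (S≗T : S ≗ T) where

  IsSIDCode-resp-≗ : IsSIDCode G S → IsSIDCode G T
  IsSIDCode-resp-≗ ((c , Sc) , dominating , identifying) =
    (c , trans (sym (S≗T c)) Sc) ,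
    (λ v → let c , Sc , c∈N[v] = dominating v in c , trans (sym (S≗T c)) Sc , c∈N[v]) ,
    λ v w → (λ H → proj₁ (identifying v w) (λ c Sc → H c (trans (sym (S≗T c)) Sc))) ,
            (λ w≡v c Tc → proj₂ (identifying v w) w≡v c (trans (S≗T c) Tc))

  card-resp-≗ : card G S ≡ card G T
  card-resp-≗ = cong List.sum (List.map-cong (cong ind ∘ S≗T) (vertices G))

module _ (m n : ℕ) where

  private
    G : Graph
    G = KmxPn m n

  ∀-vertex? : {P : Fin m × Fin n → Set} → (∀ v → Dec (P v)) → Dec (∀ v → P v)
  ∀-vertex? P? with Fin.all? (λ i → Fin.all? (λ j → P? (i , j)))
  ... | yes all = yes λ (i , j) → all i j
  ... | no ¬all = no λ all → ¬all (λ i j → all (i , j))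

  ∃-vertex? : {P : Fin m × Fin n → Set} → (∀ v → Dec (P v)) → Dec (∃ P)
  ∃-vertex? P? with Fin.any? (λ i → Fin.any? (λ j → P? (i , j)))
  ... | yes (i , j , p) = yes ((i , j) , p)
  ... | no ¬any         = no λ ((i , j) , p) → ¬any (i , j , p)

  _∈N[_]? : (c v : Fin m × Fin n) → Dec (_∈N[_] {G} c v)
  (i′ , j′) ∈N[ (i , j) ]? =
    ≡-dec Fin._≟_ Fin._≟_ (i′ , j′) (i , j)
      ⊎-dec (¬? (i Fin.≟ i′) ×-dec ((suc (toℕ j) ≟ toℕ j′) ⊎-dec (suc (toℕ j′) ≟ toℕ j)))

  isSIDCode? : ∀ S → Dec (IsSIDCode G S)
  isSIDCode? S =
    ∃-vertex? (λ c → S c Bool.≟ true)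
      ×-dec ∀-vertex? (λ v → ∃-vertex? (λ c → (S c Bool.≟ true) ×-dec c ∈N[ v ]?))
      ×-dec ∀-vertex? (λ v → ∀-vertex? (λ w → (separates? v w →-dec ≡-dec Fin._≟_ Fin._≟_ w v)
                                            ×-dec (≡-dec Fin._≟_ Fin._≟_ w v →-dec separates? v w)))
    where
    separates? : ∀ v w → Dec (∀ c → S c ≡ true → _∈N[_] {G} c v → _∈N[_] {G} w c)
    separates? v w = ∀-vertex? (λ c → (S c Bool.≟ true) →-dec (c ∈N[ v ]? →-dec w ∈N[ c ]?))

  fromSubset : Data.Fin.Subset.Subset (m * n) → Subset G
  fromSubset s (i , j) = lookup s (combine i j)

  fromSubset-tabulate : ∀ S → fromSubset (tabulateᵛ (S ∘ remQuot n)) ≗ S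
  fromSubset-tabulate S (i , j) = trans (lookup∘tabulate (S ∘ remQuot n) (combine i j)) (cong S (Fin.remQuot-combine i j))

  ∃-code? : ∀ k → Dec (∃ λ S → IsSIDCode G S × card G S ≤ k)
  ∃-code? k = Relation.Nullary.Decidable.map′
    (λ (s , code , size) → fromSubset s , code , size)
    (λ (S , code , size) → let S≗ = λ v → sym (fromSubset-tabulate S v) in
      tabulateᵛ (S ∘ remQuot n) , IsSIDCode-resp-≗ G S≗ code , subst (_≤ k) (card-resp-≗ G S≗) size)
    (anySubset? λ s → isSIDCode? (fromSubset s) ×-dec (card G (fromSubset s) ≤? k))

  sidNumber-exists : ∀ S → IsSIDCode G S → ∃ λ γ → IsSIDNumber G γ × γ ≤ card G S
  sidNumber-exists S code with least-witness _ ∃-code? (card G S) (S , code , ≤-refl)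
  ... | γ , (S₀ , code₀ , S₀≤γ) , minimal =
    γ , ((S₀ , code₀ , ≤-antisym S₀≤γ (minimal _ (S₀ , code₀ , ≤-refl))) ,
         (λ S′ code′ → minimal _ (S′ , code′ , ≤-refl))) ,
    minimal _ (S , code , ≤-refl)

-- The window inequality

elsewhere? : ∀ {m} (x : Fin m → Bool) (a : Fin m) → (∃ λ q → q ≢ a × x q ≡ true) ⊎ (∀ q → q ≢ a → x q ≡ false)
elsewhere? x a with Fin.any? (λ q → ¬? (q Fin.≟ a) ×-dec (x q Bool.≟ true))
... | yes found = inj₁ found
... | no ¬found = inj₂ λ q q≢a → Bool.¬-not λ xq → ¬found (q , q≢a , xq)

data Occurrences {m} (x : Fin m → Bool) (b : Bool) : Set where
  none : (∀ k → x k ≡ not b) → Occurrences x b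
  only : ∀ a → x a ≡ b → (∀ k → k ≢ a → x k ≡ not b) → Occurrences x b
  two  : ∀ {a c} → c ≢ a → x a ≡ b → x c ≡ b → Occurrences x b

occurrences : ∀ {m} (x : Fin m → Bool) b → Occurrences x b
occurrences x b with Fin.any? (λ k → x k Bool.≟ b)
... | no ¬found = none λ k → Bool.¬-not λ xk → ¬found (k , xk)
... | yes (a , xa) with Fin.any? (λ k → ¬? (k Fin.≟ a) ×-dec (x k Bool.≟ b))
...   | yes (c , c≢a , xc) = two c≢a xa xc
...   | no ¬found = only a xa λ k k≢a → Bool.¬-not λ xk → ¬found (k , k≢a , xk)

-- What separating a vertex (i , j) of the middle column from (k , j), (i , j ± 2) and (a , j ± 1)
-- forces on three consecutive columns x, y, z of a code.
record Window {m} (x y z : Fin m → Bool) : Set where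
  field
    covered     : ∀ {i k} → y i ≡ false → k ≢ i → x k ≡ true ⊎ z k ≡ true
    left-meets  : ∀ {i} → y i ≡ false → ∃ λ k → k ≢ i × x k ≡ true
    right-meets : ∀ {i} → y i ≡ false → ∃ λ k → k ≢ i × z k ≡ true
    left-pair   : ∀ {i a} → a ≢ i → (∀ k → k ≢ i → z k ≡ false) → ∃ λ k → (k ≢ i × k ≢ a) × x k ≡ true
    right-pair  : ∀ {i a} → a ≢ i → (∀ k → k ≢ i → x k ≡ false) → ∃ λ k → (k ≢ i × k ≢ a) × z k ≡ true

Supported : ∀ {m} → (Fin m → Bool) → (Fin m → Bool) → Set
Supported x y = ∀ {i} → x i ≡ false → ∃ λ k → k ≢ i × y k ≡ true

supported-at : ∀ {m} {x y : Fin m → Bool} {a} → Supported x y → (∀ k → k ≢ a → y k ≡ false) → x a ≡ true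
supported-at supported y⊆a = Bool.¬-not λ xa →
  let k , k≢a , yk = supported xa in Bool.not-¬ yk (y⊆a k k≢a)

module _ {m′ : ℕ} {x y z : Fin (3 + m′) → Bool} (W : Window x y z) (x-supported : Supported x y) where
  open Window W

  private
    m = 3 + m′
    X = count x
    Y = count y
    Z = count z

    outer-≥2 : 2 ≤ X + Z
    outer-≥2 with occurrences z true
    ... | two q≢k zk zq = ≤-trans (2≤count z zk zq (≢-sym q≢k)) (m≤n+m Z X)
    ... | only k zk _ with elsewhere? x k
    ...   | inj₁ (q , _ , xq) = +-mono-≤ (1≤count x xq) (1≤count z zk)
    ...   | inj₂ x⊆k =
            let a , a≢k = avoid-one k
                q , (q≢k , _) , zq = right-pair a≢k x⊆k
            in ≤-trans (2≤count z zk zq (≢-sym q≢k)) (m≤n+m Z X)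
    outer-≥2 | none z-empty =
      let a , a≢0 = avoid-one zero
          z⊆0 = λ k _ → z-empty k
          k₁ , (k₁≢0 , _) , xk₁ = left-pair a≢0 z⊆0
          k₂ , (_ , k₂≢k₁) , xk₂ = left-pair k₁≢0 z⊆0
      in ≤-trans (2≤count x xk₁ xk₂ (≢-sym k₂≢k₁)) (m≤m+n X Z)

    outer-≥3 : ∀ {i} → y i ≡ false → 3 ≤ X + Z
    outer-≥3 {i} yi with left-meets yi | right-meets yi
    ... | a , a≢i , xa | b , b≢i , zb with a Fin.≟ b
    ...   | yes refl =
            let k , k≢i , k≢a = avoid-two i a in
            [ (λ xk → +-mono-≤ (2≤count x xa xk (≢-sym k≢a)) (1≤count z zb))
            , (λ zk → +-mono-≤ (1≤count x xa) (2≤count z zb zk (≢-sym k≢a))) ]′ (covered yi k≢i)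
    ...   | no a≢b with elsewhere? x a
    ...     | inj₁ (q , q≢a , xq) = +-mono-≤ (2≤count x xa xq (≢-sym q≢a)) (1≤count z zb)
    ...     | inj₂ x⊆a =
              let q , (_ , q≢b) , zq = right-pair (≢-sym a≢b) x⊆a
              in +-mono-≤ (1≤count x xa) (2≤count z zb zq (≢-sym q≢b))

    outer-cover : ∀ {i j} → j ≢ i → y i ≡ false → y j ≡ false → ∀ k → x k ≡ true ⊎ z k ≡ true
    outer-cover {i} j≢i yi yj k with k Fin.≟ i
    ... | yes refl = covered yj (≢-sym j≢i)
    ... | no k≢i   = covered yi k≢i

    via-middle : ∀ {p q} → p ≤ Y → q ≤ X + Z → p + q ≤ X + (Y + Z)
    via-middle {p} {q} p≤Y q≤X+Z = subst (p + q ≤_) (sym (x∙yz≈y∙xz X Y Z)) (+-mono-≤ p≤Y q≤X+Z)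

    window-core : (m + 2 ≤ X + (Y + Z)) ⊎
      (∃ λ a → y a ≡ true × (∀ k → k ≢ a → y k ≡ false) × (∀ k → x k ≡ true ⊎ z k ≡ true))
    window-core with occurrences y false
    ... | none y-full = inj₁ (via-middle (≤-reflexive (sym (count-full y y-full))) outer-≥2)
    ... | only i yi y-full-off-i = inj₁ (begin
        m + 2      ≤⟨ +-monoˡ-≤ 2 (count-all-but-one y i y-full-off-i) ⟩
        suc Y + 2  ≡⟨ sym (+-suc Y 2) ⟩
        Y + 3      ≤⟨ via-middle ≤-refl (outer-≥3 yi) ⟩
        X + (Y + Z) ∎)
      where open ≤-Reasoning
    ... | two j≢i yi yj with occurrences y true
    ...   | two b≢a ya yb =
            inj₁ (subst (_≤ X + (Y + Z)) (+-comm 2 m)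
              (via-middle (2≤count y ya yb (≢-sym b≢a)) (count-cover x z (outer-cover j≢i yi yj))))
    ...   | only a ya y⊆a = inj₂ (a , ya , y⊆a , outer-cover j≢i yi yj)
    ...   | none y-empty = inj₁ (begin
        m + 2        ≡⟨ cong (_+ 2) (sym (count-full x x-full)) ⟩
        X + 2        ≤⟨ +-monoʳ-≤ X z-≥2 ⟩
        X + Z        ≤⟨ +-monoʳ-≤ X (m≤n+m Z Y) ⟩
        X + (Y + Z)  ∎)
      where
      open ≤-Reasoning
      x-full : ∀ k → x k ≡ true
      x-full k = supported-at x-supported (λ q _ → y-empty q)
      z-≥2 : 2 ≤ Z
      z-≥2 = let b , b≢i , zb = right-meets yi
                 c , c≢b , zc = right-meets (y-empty b)
             in 2≤count z zb zc (≢-sym c≢b)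

  window-≥m+1 : m + 1 ≤ X + (Y + Z)
  window-≥m+1 with window-core
  ... | inj₁ m+2≤ = ≤-trans (+-monoʳ-≤ m (n≤1+n 1)) m+2≤
  ... | inj₂ (a , ya , _ , cover) =
        subst (_≤ X + (Y + Z)) (+-comm 1 m) (via-middle (1≤count y ya) (count-cover x z cover))

  window-≥m+2 : Supported z y → m + 2 ≤ X + (Y + Z)
  window-≥m+2 z-supported with window-core
  ... | inj₁ m+2≤ = m+2≤
  ... | inj₂ (a , ya , y⊆a , cover) =
        subst (_≤ X + (Y + Z)) (+-comm 2 m)
          (via-middle (1≤count y ya)
            (count-cover-twice x z a cover (supported-at x-supported y⊆a) (supported-at z-supported y⊆a)))

-- col S t is column t − 1 of S, padded with an empty column 0 and empty columns beyond n,
-- so that the two neighbouring columns of any real column exist.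
col : ∀ {m n} → (Fin m × Fin n → Bool) → ℕ → Fin m → Bool
col S zero    i = false
col {n = n} S (suc t) i with t <? n
... | yes t<n = S (i , fromℕ< t<n)
... | no  _   = false

Next : ∀ {n} → Fin n → Fin n → Set
Next j c = suc (toℕ j) ≡ toℕ c

module _ {m n : ℕ} (S : Fin m × Fin n → Bool) where

  col-suc-toℕ : ∀ (j : Fin n) i → col S (suc (toℕ j)) i ≡ S (i , j)
  col-suc-toℕ j i with toℕ j <? n
  ... | yes j<n = cong (λ c → S (i , c)) (Fin.fromℕ<-toℕ j j<n)
  ... | no  j≮n = ⊥-elim (j≮n (Fin.toℕ<n j))

  col-suc : ∀ {t} i (t<n : t < n) → col S (suc t) i ≡ S (i , fromℕ< t<n)
  col-suc {t} i t<n with t <? n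
  ... | yes _   = refl
  ... | no  t≮n = ⊥-elim (t≮n t<n)

  col-beyond : ∀ {t} i → n ≤ t → col S (suc t) i ≡ false
  col-beyond {t} i n≤t with t <? n
  ... | yes t<n = ⊥-elim (<⇒≱ t<n n≤t)
  ... | no  _   = refl

  col-right : ∀ j {c k} → Next j c → col S (2 + toℕ j) k ≡ S (k , c)
  col-right j {c} {k} j⋖c = trans (cong (λ t → col S (suc t) k) j⋖c) (col-suc-toℕ c k)

  col-left : ∀ j {c k} → Next c j → col S (toℕ j) k ≡ S (k , c)
  col-left j {c} {k} c⋖j = trans (cong (λ t → col S t k) (sym c⋖j)) (col-suc-toℕ c k)

  rows-differ : ∀ {k k′ c} → S (k′ , c) ≡ true → S (k , c) ≡ false → k′ ≢ k
  rows-differ S-k′ S-k refl = Bool.not-¬ S-k′ S-k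

other-column : ∀ {m n} {i a : Fin m} {j b : Fin n} → toℕ b ≢ toℕ j → (a , b) ≢ (i , j)
other-column b≢j refl = b≢j refl

module _ {m n : ℕ} (S : Fin m × Fin n → Bool) (code : IsSIDCode (KmxPn m n) S) where

  private
    _∈N_ : Fin m × Fin n → Fin m × Fin n → Set
    w ∈N v = _∈N[_] {KmxPn m n} w v

    ∈N-right : ∀ {a k b c} → k ≢ a → suc (toℕ c) ≡ toℕ b → (a , b) ∈N (k , c)
    ∈N-right k≢a c⋖b = inj₂ (k≢a , inj₁ c⋖b)

    ∈N-left : ∀ {a k b c} → k ≢ a → suc (toℕ b) ≡ toℕ c → (a , b) ∈N (k , c)
    ∈N-left k≢a b⋖c = inj₂ (k≢a , inj₂ b⋖c)

  separation : ∀ {i j} w → w ≢ (i , j) →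
    (S (i , j) ≡ true → w ∈N (i , j)) →
    (∀ {k} c → k ≢ i → Next j c → S (k , c) ≡ true → w ∈N (k , c)) →
    (∀ {k} c → k ≢ i → Next c j → S (k , c) ≡ true → w ∈N (k , c)) → ⊥
  separation {i} {j} w w≢v self right left = w≢v (proj₁ (proj₂ (proj₂ code) (i , j) w) covers)
    where
    covers : ∀ c → S c ≡ true → c ∈N (i , j) → w ∈N c
    covers c       Sc (inj₁ refl)              = self Sc
    covers (k , c) Sc (inj₂ (i≢k , inj₁ j⋖c)) = right c (≢-sym i≢k) j⋖c Sc
    covers (k , c) Sc (inj₂ (i≢k , inj₂ c⋖j)) = left c (≢-sym i≢k) c⋖j Sc

  private
    absent : ∀ {j i} {A : Set} → col S (suc (toℕ j)) i ≡ false → S (i , j) ≡ true → A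
    absent {j} {i} yi S-ij = ⊥-elim (Bool.not-¬ S-ij (trans (sym (col-suc-toℕ S j i)) yi))

    left-absent : ∀ j {i k c} {A : Set} → (∀ k → k ≢ i → col S (toℕ j) k ≡ false) →
      k ≢ i → Next c j → S (k , c) ≡ true → A
    left-absent j {c = c} x⊆i k≢i c⋖j S-kc =
      ⊥-elim (Bool.not-¬ S-kc (trans (sym (col-left S j {c} c⋖j)) (x⊆i _ k≢i)))

    right-absent : ∀ j {i k c} {A : Set} → (∀ k → k ≢ i → col S (2 + toℕ j) k ≡ false) →
      k ≢ i → Next j c → S (k , c) ≡ true → A
    right-absent j {c = c} z⊆i k≢i j⋖c S-kc =
      ⊥-elim (Bool.not-¬ S-kc (trans (sym (col-right S j {c} j⋖c)) (z⊆i _ k≢i)))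

  covered-at : ∀ j {i k} → col S (suc (toℕ j)) i ≡ false → k ≢ i →
    col S (toℕ j) k ≡ true ⊎ col S (2 + toℕ j) k ≡ true
  covered-at j {i} {k} yi k≢i with col S (toℕ j) k in xk | col S (2 + toℕ j) k in zk
  ... | true  | _     = inj₁ refl
  ... | false | true  = inj₂ refl
  ... | false | false = ⊥-elim (separation (k , j) (k≢i ∘ cong proj₁) (absent yi)
      (λ c _ j⋖c S-k′c → ∈N-left (rows-differ S S-k′c (trans (sym (col-right S j {c} j⋖c)) zk)) j⋖c)
      (λ c _ c⋖j S-k′c → ∈N-right (rows-differ S S-k′c (trans (sym (col-left S j {c} c⋖j)) xk)) c⋖j))

  left-meets-at : ∀ j {i} → 2 + toℕ j < n → col S (suc (toℕ j)) i ≡ false →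
    ∃ λ k → k ≢ i × col S (toℕ j) k ≡ true
  left-meets-at j {i} j+2<n yi = witness (col S (toℕ j)) (λ k → ¬? (k Fin.≟ i)) impossible
    where
    j₂ : Fin n
    j₂ = fromℕ< j+2<n
    impossible : ¬ (∀ k → k ≢ i → col S (toℕ j) k ≡ false)
    impossible x⊆i =
      separation (i , j₂) (other-column λ e → m≢1+n+m (toℕ j) (trans (sym e) (Fin.toℕ-fromℕ< j+2<n))) (absent yi)
        (λ c k≢i j⋖c _ → ∈N-right k≢i (trans (cong suc (sym j⋖c)) (sym (Fin.toℕ-fromℕ< j+2<n))))
        (λ c k≢i c⋖j → left-absent j x⊆i k≢i c⋖j)

  right-meets-at : ∀ j {i t} → toℕ j ≡ 2 + t → col S (suc (toℕ j)) i ≡ false →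
    ∃ λ k → k ≢ i × col S (2 + toℕ j) k ≡ true
  right-meets-at j {i} {t} j≡2+t yi = witness (col S (2 + toℕ j)) (λ k → ¬? (k Fin.≟ i)) impossible
    where
    t<n : t < n
    t<n = ≤-trans (m≤n+m (suc t) 2) (subst (_< n) j≡2+t (Fin.toℕ<n j))
    j₂ : Fin n
    j₂ = fromℕ< t<n
    impossible : ¬ (∀ k → k ≢ i → col S (2 + toℕ j) k ≡ false)
    impossible z⊆i =
      separation (i , j₂) (other-column λ e → m≢1+n+m t (trans (sym (Fin.toℕ-fromℕ< t<n)) (trans e j≡2+t))) (absent yi)
        (λ c k≢i j⋖c → right-absent j z⊆i k≢i j⋖c)
        (λ c k≢i c⋖j _ → ∈N-left k≢i (trans (cong suc (Fin.toℕ-fromℕ< t<n)) (sym (suc-injective (trans c⋖j j≡2+t)))))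

  left-pair-at : ∀ j {i a t} → toℕ j ≡ suc t → a ≢ i → (∀ k → k ≢ i → col S (2 + toℕ j) k ≡ false) →
    ∃ λ k → (k ≢ i × k ≢ a) × col S (toℕ j) k ≡ true
  left-pair-at j {i} {a} {t} j≡1+t a≢i z⊆i =
    witness (col S (toℕ j)) (λ k → ¬? (k Fin.≟ i) ×-dec ¬? (k Fin.≟ a)) impossible
    where
    t<n : t < n
    t<n = ≤-trans (n≤1+n (suc t)) (subst (_< n) j≡1+t (Fin.toℕ<n j))
    j₁ : Fin n
    j₁ = fromℕ< t<n
    impossible : ¬ (∀ k → k ≢ i × k ≢ a → col S (toℕ j) k ≡ false)
    impossible x⊆ia =
      separation (a , j₁) (other-column λ e → 1+n≢n (sym (trans (sym (Fin.toℕ-fromℕ< t<n)) (trans e j≡1+t))))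
        (λ _ → ∈N-left (≢-sym a≢i) (trans (cong suc (Fin.toℕ-fromℕ< t<n)) (sym j≡1+t)))
        (λ c k≢i j⋖c → right-absent j z⊆i k≢i j⋖c)
        left
      where
      left : ∀ {k} c → k ≢ i → Next c j → S (k , c) ≡ true → (a , j₁) ∈N (k , c)
      left {k} c k≢i c⋖j S-kc with k Fin.≟ a
      ... | yes refl = inj₁ (cong (a ,_) (Fin.toℕ-injective
                         (trans (Fin.toℕ-fromℕ< t<n) (sym (suc-injective (trans c⋖j j≡1+t))))))
      ... | no  k≢a  = ⊥-elim (Bool.not-¬ S-kc (trans (sym (col-left S j {c} c⋖j)) (x⊆ia k (k≢i , k≢a))))

  right-pair-at : ∀ j {i a} → suc (toℕ j) < n → a ≢ i → (∀ k → k ≢ i → col S (toℕ j) k ≡ false) →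
    ∃ λ k → (k ≢ i × k ≢ a) × col S (2 + toℕ j) k ≡ true
  right-pair-at j {i} {a} j+1<n a≢i x⊆i =
    witness (col S (2 + toℕ j)) (λ k → ¬? (k Fin.≟ i) ×-dec ¬? (k Fin.≟ a)) impossible
    where
    j₁ : Fin n
    j₁ = fromℕ< j+1<n
    impossible : ¬ (∀ k → k ≢ i × k ≢ a → col S (2 + toℕ j) k ≡ false)
    impossible z⊆ia =
      separation (a , j₁) (other-column λ e → 1+n≢n (trans (sym (Fin.toℕ-fromℕ< j+1<n)) e))
        (λ _ → ∈N-right (≢-sym a≢i) (sym (Fin.toℕ-fromℕ< j+1<n)))
        right
        (λ c k≢i c⋖j → left-absent j x⊆i k≢i c⋖j)
      where
      right : ∀ {k} c → k ≢ i → Next j c → S (k , c) ≡ true → (a , j₁) ∈N (k , c)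
      right {k} c k≢i j⋖c S-kc with k Fin.≟ a
      ... | yes refl = inj₁ (cong (a ,_) (Fin.toℕ-injective (trans (Fin.toℕ-fromℕ< j+1<n) j⋖c)))
      ... | no  k≢a  = ⊥-elim (Bool.not-¬ S-kc (trans (sym (col-right S j {c} j⋖c)) (z⊆ia k (k≢i , k≢a))))

at-every-column : ∀ {n} {P : ℕ → Set} → (∀ (j : Fin n) → P (toℕ j)) → ∀ {u} → u < n → P u
at-every-column {P = P} P-at u<n = subst P (Fin.toℕ-fromℕ< u<n) (P-at (fromℕ< u<n))

full-if-supported-by : ∀ {m} {x y : Fin m → Bool} → Supported x y → (∀ k → y k ≡ false) → ∀ k → x k ≡ true
full-if-supported-by supported y-empty k = Bool.¬-not λ xk →
  let k′ , _ , yk′ = supported xk in Bool.not-¬ yk′ (y-empty k′)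

<-weaken : ∀ k {a n} → k + a < n → a < n
<-weaken k k+a<n = ≤-trans (s≤s (m≤n+m _ k)) k+a<n

3≤count-if-pairs-avoided : ∀ {m} (x : Fin (3 + m) → Bool) →
  (∀ {i a} → a ≢ i → ∃ λ k → (k ≢ i × k ≢ a) × x k ≡ true) → 3 ≤ count x
3≤count-if-pairs-avoided x avoided =
  let k₁ , (k₁≢0 , _) , xk₁ = avoided {zero} {suc zero} λ ()
      a , a≢k₁ = avoid-one k₁
      k₂ , (k₂≢k₁ , _) , xk₂ = avoided a≢k₁
      k₃ , (k₃≢k₂ , k₃≢k₁) , xk₃ = avoided (≢-sym k₂≢k₁)
  in 3≤count x xk₁ xk₂ xk₃ (≢-sym k₂≢k₁) (≢-sym k₃≢k₁) (≢-sym k₃≢k₂)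

column-count : ∀ {m n} → (Fin m × Fin n → Bool) → ℕ → ℕ
column-count S t = count (col S (suc t))

module _ {m′ n : ℕ} (S : Fin (3 + m′) × Fin n → Bool) (code : IsSIDCode (KmxPn (3 + m′) n) S) where

  private
    m = 3 + m′

  supported-from-left : ∀ {u} → u < n → 2 + u < n → Supported (col S (suc u)) (col S u)
  supported-from-left = at-every-column {P = λ u → 2 + u < n → Supported (col S (suc u)) (col S u)}
    λ j j+2<n → left-meets-at S code j j+2<n

  supported-from-right : ∀ t → 2 + t < n → Supported (col S (3 + t)) (col S (4 + t))
  supported-from-right t 2+t<n = at-every-column {P = λ u → u ≡ 2 + t → Supported (col S (suc u)) (col S (2 + u))}
    (λ j j≡2+t → right-meets-at S code j j≡2+t) 2+t<n refl

  window-at : ∀ t → 4 + t < n → Window (col S (2 + t)) (col S (3 + t)) (col S (4 + t))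
  window-at t 4+t<n = at-every-column {P = λ u → u ≡ 2 + t → Window (col S u) (col S (suc u)) (col S (2 + u))}
    (λ j j≡2+t → record
      { covered     = covered-at S code j
      ; left-meets  = left-meets-at S code j (subst (λ u → 2 + u < n) (sym j≡2+t) 4+t<n)
      ; right-meets = right-meets-at S code j j≡2+t
      ; left-pair   = left-pair-at S code j j≡2+t
      ; right-pair  = right-pair-at S code j (subst (λ u → 1 + u < n) (sym j≡2+t) (≤-trans (n≤1+n _) 4+t<n))
      })
    (≤-trans (m≤n+m (3 + t) 2) 4+t<n) refl

  first-column-full : 2 < n → column-count S 0 ≡ m
  first-column-full 2<n = count-full (col S 1) (full-if-supported-by (supported-from-left (<-weaken 2 2<n) 2<n) (λ _ → refl))

  second-column-≥3 : 1 < n → 3 ≤ column-count S 1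
  second-column-≥3 1<n = 3≤count-if-pairs-avoided (col S 2) λ a≢i →
    at-every-column {P = λ u → 1 + u < n → ∀ {i a} → a ≢ i → (∀ k → k ≢ i → col S u k ≡ false) →
                               ∃ λ k → (k ≢ i × k ≢ a) × col S (2 + u) k ≡ true}
      (λ j j+1<n a≢i → right-pair-at S code j j+1<n a≢i) (<-weaken 1 1<n) 1<n a≢i (λ _ _ → refl)

  last-column-full : ∀ t → 3 + t ≡ n → column-count S (2 + t) ≡ m
  last-column-full t 3+t≡n = count-full (col S (3 + t)) (full-if-supported-by
    (supported-from-right t (≤-reflexive 3+t≡n)) (λ k → col-beyond S k (≤-reflexive (sym 3+t≡n))))

  penultimate-column-≥3 : ∀ t → 3 + t ≡ n → 3 ≤ column-count S (1 + t)
  penultimate-column-≥3 t 3+t≡n = 3≤count-if-pairs-avoided (col S (2 + t)) λ a≢i →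
    at-every-column {P = λ u → u ≡ 2 + t → ∀ {i a} → a ≢ i → (∀ k → k ≢ i → col S (2 + u) k ≡ false) →
                               ∃ λ k → (k ≢ i × k ≢ a) × col S u k ≡ true}
      (λ j j≡2+t a≢i → left-pair-at S code j j≡2+t a≢i) (≤-reflexive 3+t≡n) refl a≢i
      (λ k _ → col-beyond S k (≤-reflexive (sym 3+t≡n)))

  window-sum : ∀ t → 6 + t < n → m + 2 ≤ column-count S (2 + t) + (column-count S (3 + t) + column-count S (4 + t))
  window-sum t 6+t<n = window-≥m+2 (window-at (suc t) (<-weaken 1 6+t<n))
    (supported-from-right t (<-weaken 4 6+t<n)) (supported-from-left (<-weaken 2 6+t<n) 6+t<n)

  last-window-sum : ∀ t → 6 + t ≡ n → m + 1 ≤ column-count S (2 + t) + (column-count S (3 + t) + column-count S (4 + t))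
  last-window-sum t 6+t≡n = window-≥m+1 (window-at (suc t) (≤-reflexive 6+t≡n))
    (supported-from-right t (<-weaken 3 (≤-reflexive 6+t≡n)))

-- Lower bound

∑< : ℕ → (ℕ → ℕ) → ℕ
∑< zero    f = 0
∑< (suc n) f = f 0 + ∑< n (f ∘ suc)

∑<-cong : ∀ n {f g} → (∀ t → f t ≡ g t) → ∑< n f ≡ ∑< n g
∑<-cong zero    f≗g = refl
∑<-cong (suc n) f≗g = cong₂ _+_ (f≗g 0) (∑<-cong n (f≗g ∘ suc))

∑<-mono : ∀ n {f g} → (∀ t → t < n → f t ≤ g t) → ∑< n f ≤ ∑< n g
∑<-mono zero    f≤g = z≤n
∑<-mono (suc n) f≤g = +-mono-≤ (f≤g 0 (s≤s z≤n)) (∑<-mono n λ t t<n → f≤g (suc t) (s≤s t<n))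

∑<-const : ∀ n c → ∑< n (λ _ → c) ≡ n * c
∑<-const zero    c = refl
∑<-const (suc n) c = cong (c +_) (∑<-const n c)

∑<-+ : ∀ a b f → ∑< (a + b) f ≡ ∑< a f + ∑< b (λ t → f (t + a))
∑<-+ zero    b f = ∑<-cong b λ t → cong f (sym (+-identityʳ t))
∑<-+ (suc a) b f = begin
  f 0 + ∑< (a + b) (f ∘ suc)
    ≡⟨ cong (f 0 +_) (∑<-+ a b (f ∘ suc)) ⟩
  f 0 + (∑< a (f ∘ suc) + ∑< b (λ t → f (suc (t + a))))
    ≡⟨ sym (+-assoc (f 0) _ _) ⟩
  f 0 + ∑< a (f ∘ suc) + ∑< b (λ t → f (suc (t + a)))
    ≡⟨ cong (f 0 + ∑< a (f ∘ suc) +_) (∑<-cong b λ t → cong f (sym (+-suc t a))) ⟩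
  f 0 + ∑< a (f ∘ suc) + ∑< b (λ t → f (t + suc a))
    ∎
  where open ≡-Reasoning

∑<-triples : ∀ k f → ∑< (k * 3) f ≡ ∑< k (λ p → f (p * 3) + (f (1 + p * 3) + f (2 + p * 3)))
∑<-triples zero    f = refl
∑<-triples (suc k) f = trans (sym (+-assoc (f 0) _ _)) (trans (sym (+-assoc (f 0 + f 1) _ _))
  (cong₂ _+_ (+-assoc (f 0) (f 1) (f 2)) (∑<-triples k (λ t → f (3 + t)))))

∑-toℕ : ∀ {n} (g : ℕ → ℕ) → sum {n} (g ∘ toℕ) ≡ ∑< n g
∑-toℕ {zero}  g = refl
∑-toℕ {suc n} g = cong (g 0 +_) (∑-toℕ {n} (g ∘ suc))

ceil3-step : ∀ a → ceil3 (3 + a) ≡ suc (ceil3 a)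
ceil3-step a = m/n≡1+[m∸n]/n {3 + a + 2} {3} (s≤s (s≤s (s≤s z≤n)))

ceil3-+3k : ∀ k a → ceil3 (k * 3 + a) ≡ k + ceil3 a
ceil3-+3k zero    a = refl
ceil3-+3k (suc k) a = trans (ceil3-step (k * 3 + a)) (cong suc (ceil3-+3k k a))

split-columns : ∀ f k b → ∑< (2 + (b + k * 3)) f ≡
  f 0 + (f 1 + (∑< (k * 3) (λ t → f (2 + t)) + ∑< b (λ t → f (2 + (t + k * 3)))))
split-columns f k b = cong (λ s → f 0 + (f 1 + s))
  (trans (cong (λ s → ∑< s (λ t → f (2 + t))) (+-comm b (k * 3))) (∑<-+ (k * 3) b (λ t → f (2 + t))))

ceil3-of : ∀ k r {n} → 4 + (r + k * 3) ≡ n → ceil3 (n + 1) ≡ k + ceil3 (5 + r)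
ceil3-of k r {n} n≡ = begin
  ceil3 (n + 1)                  ≡⟨ cong (λ q → ceil3 (q + 1)) (sym n≡) ⟩
  ceil3 (4 + (r + k * 3) + 1)    ≡⟨ cong ceil3 (rearrange r (k * 3)) ⟩
  ceil3 (k * 3 + (5 + r))        ≡⟨ ceil3-+3k k (5 + r) ⟩
  k + ceil3 (5 + r)              ∎
  where
  open ≡-Reasoning
  rearrange : ∀ r K → 4 + (r + K) + 1 ≡ K + (5 + r)
  rearrange = solve-∀

data Mod3 : ℕ → Set where
  rem₀ : ∀ k → Mod3 (k * 3)
  rem₁ : ∀ k → Mod3 (1 + k * 3)
  rem₂ : ∀ k → Mod3 (2 + k * 3)

mod3 : ∀ t → Mod3 t
mod3 zero = rem₀ 0
mod3 (suc t) with mod3 t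
... | rem₀ k = rem₁ k
... | rem₁ k = rem₂ k
... | rem₂ k = rem₀ (suc k)

module _ (m n : ℕ) (f : ℕ → ℕ)
  (first       : f 0 ≡ m)
  (second      : 3 ≤ f 1)
  (penultimate : ∀ t → 3 + t ≡ n → 3 ≤ f (1 + t))
  (last        : ∀ t → 3 + t ≡ n → f (2 + t) ≡ m)
  (window      : ∀ t → 6 + t < n → m + 2 ≤ f (2 + t) + (f (3 + t) + f (4 + t)))
  (last-window : ∀ t → 6 + t ≡ n → m + 1 ≤ f (2 + t) + (f (3 + t) + f (4 + t)))
  where

  private
    h : ℕ → ℕ
    h t = f (2 + t)

    windows-≥ : ∀ k → 4 + k * 3 ≤ n → k * (m + 2) ≤ ∑< (k * 3) h
    windows-≥ k 4+3k≤n = begin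
      k * (m + 2)                                               ≡⟨ sym (∑<-const k (m + 2)) ⟩
      ∑< k (λ _ → m + 2)                                        ≤⟨ ∑<-mono k (λ p p<k → window (p * 3)
                                                                     (≤-trans (+-monoʳ-≤ 4 (*-monoˡ-≤ 3 p<k)) 4+3k≤n)) ⟩
      ∑< k (λ p → h (p * 3) + (h (1 + p * 3) + h (2 + p * 3))) ≡⟨ sym (∑<-triples k h) ⟩
      ∑< (k * 3) h                                              ∎
      where open ≤-Reasoning

    prefix-≥ : ∀ k b {T} → 4 + k * 3 ≤ n → T ≤ ∑< b (λ t → h (t + k * 3)) →
      m + (3 + (k * (m + 2) + T)) ≤ ∑< (2 + (b + k * 3)) f
    prefix-≥ k b {T} 4+3k≤n T≤tail = begin
      m + (3 + (k * (m + 2) + T))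
        ≤⟨ +-mono-≤ (≤-reflexive (sym first)) (+-mono-≤ second (+-mono-≤ (windows-≥ k 4+3k≤n) T≤tail)) ⟩
      f 0 + (f 1 + (∑< (k * 3) h + ∑< b (λ t → h (t + k * 3))))
        ≡⟨ sym (split-columns f k b) ⟩
      ∑< (2 + (b + k * 3)) f
        ∎
      where open ≤-Reasoning

    bound-rem₀ : ∀ k → 4 + k * 3 ≡ n → (k + 2) * (m + 2) ≤ 2 + ∑< n f
    bound-rem₀ k n≡ = begin
      (k + 2) * (m + 2)                                   ≤⟨ m≤m+n _ 4 ⟩
      (k + 2) * (m + 2) + 4                               ≡⟨ arithmetic k m ⟩
      2 + (m + (3 + (k * (m + 2) + (3 + (m + 0)))))       ≤⟨ +-monoʳ-≤ 2 (prefix-≥ k 2 (≤-reflexive n≡) tail) ⟩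
      2 + ∑< (4 + k * 3) f                                ≡⟨ cong (λ s → 2 + ∑< s f) n≡ ⟩
      2 + ∑< n f                                          ∎
      where
      open ≤-Reasoning
      arithmetic : ∀ k m → (k + 2) * (m + 2) + 4 ≡ 2 + (m + (3 + (k * (m + 2) + (3 + (m + 0)))))
      arithmetic = solve-∀
      tail : 3 + (m + 0) ≤ h (k * 3) + (h (1 + k * 3) + 0)
      tail = +-mono-≤ (penultimate (1 + k * 3) n≡) (+-monoˡ-≤ 0 (≤-reflexive (sym (last (1 + k * 3) n≡))))

    bound-rem₁ : ∀ k → 5 + k * 3 ≡ n → (k + 2) * (m + 2) ≤ 2 + ∑< n f
    bound-rem₁ k n≡ = begin
      (k + 2) * (m + 2)                                   ≤⟨ m≤m+n _ 4 ⟩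
      (k + 2) * (m + 2) + 4                               ≡⟨ arithmetic k m ⟩
      2 + (m + (3 + (k * (m + 2) + (0 + (3 + (m + 0)))))) ≤⟨ +-monoʳ-≤ 2 (prefix-≥ k 3 4+3k≤n tail) ⟩
      2 + ∑< (5 + k * 3) f                                ≡⟨ cong (λ s → 2 + ∑< s f) n≡ ⟩
      2 + ∑< n f                                          ∎
      where
      open ≤-Reasoning
      arithmetic : ∀ k m → (k + 2) * (m + 2) + 4 ≡ 2 + (m + (3 + (k * (m + 2) + (0 + (3 + (m + 0))))))
      arithmetic = solve-∀
      4+3k≤n : 4 + k * 3 ≤ n
      4+3k≤n = ≤-trans (m≤n+m _ 1) (≤-reflexive n≡)
      tail : 0 + (3 + (m + 0)) ≤ h (k * 3) + (h (1 + k * 3) + (h (2 + k * 3) + 0))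
      tail = +-mono-≤ (z≤n {h (k * 3)})
        (+-mono-≤ (penultimate (2 + k * 3) n≡) (+-monoˡ-≤ 0 (≤-reflexive (sym (last (2 + k * 3) n≡)))))

    bound-rem₂ : ∀ k → 6 + k * 3 ≡ n → (k + 3) * (m + 2) ≤ 2 + ∑< n f
    bound-rem₂ k n≡ = begin
      (k + 3) * (m + 2)                                   ≡⟨ arithmetic k m ⟩
      2 + (m + (3 + (k * (m + 2) + ((m + 1) + m))))       ≤⟨ +-monoʳ-≤ 2 (prefix-≥ k 4 4+3k≤n tail) ⟩
      2 + ∑< (6 + k * 3) f                                ≡⟨ cong (λ s → 2 + ∑< s f) n≡ ⟩
      2 + ∑< n f                                          ∎
      where
      open ≤-Reasoning
      arithmetic : ∀ k m → (k + 3) * (m + 2) ≡ 2 + (m + (3 + (k * (m + 2) + ((m + 1) + m))))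
      arithmetic = solve-∀
      K = k * 3
      4+3k≤n : 4 + K ≤ n
      4+3k≤n = ≤-trans (m≤n+m _ 2) (≤-reflexive n≡)
      last-column : m ≤ h (3 + K) + 0
      last-column = ≤-reflexive (sym (trans (+-identityʳ _) (last (3 + K) n≡)))
      tail : (m + 1) + m ≤ h K + (h (1 + K) + (h (2 + K) + (h (3 + K) + 0)))
      tail = begin
        (m + 1) + m                                       ≤⟨ +-mono-≤ (last-window K n≡) last-column ⟩
        (h K + (h (1 + K) + h (2 + K))) + (h (3 + K) + 0) ≡⟨ +-assoc (h K) _ _ ⟩
        h K + ((h (1 + K) + h (2 + K)) + (h (3 + K) + 0)) ≡⟨ cong (h K +_) (+-assoc (h (1 + K)) _ _) ⟩
        h K + (h (1 + K) + (h (2 + K) + (h (3 + K) + 0))) ∎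

    finish : ∀ c → ceil3 (n + 1) ≡ c → c * (m + 2) ≤ 2 + ∑< n f → ceil3 (n + 1) * (m + 2) ∸ 2 ≤ ∑< n f
    finish c ceil≡c bound = m≤n+o⇒m∸n≤o _ 2 (subst (λ q → q * (m + 2) ≤ 2 + ∑< n f) (sym ceil≡c) bound)

  columns-lower-bound : 7 ≤ n → ceil3 (n + 1) * (m + 2) ∸ 2 ≤ ∑< n f
  columns-lower-bound 7≤n with m≤n⇒∃[o]m+o≡n (m+n≤o⇒m≤o 4 7≤n)
  ... | t , 4+t≡n with mod3 t
  ...   | rem₀ k = finish (k + 2) (ceil3-of k 0 4+t≡n) (bound-rem₀ k 4+t≡n)
  ...   | rem₁ k = finish (k + 2) (ceil3-of k 1 4+t≡n) (bound-rem₁ k 4+t≡n)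
  ...   | rem₂ k = finish (k + 3) (ceil3-of k 2 4+t≡n) (bound-rem₂ k 4+t≡n)

card-by-column-counts : ∀ {m n} (S : Fin m × Fin n → Bool) → card (KmxPn m n) S ≡ ∑< n (column-count S)
card-by-column-counts {m} {n} S =
  trans (card-by-columns m n S)
    (trans (sum-cong-≗ λ j → count-cong λ i → sym (col-suc-toℕ S j i)) (∑-toℕ {n} (column-count S)))

lower-bound : ∀ {m′ n} (S : Fin (3 + m′) × Fin n → Bool) → IsSIDCode (KmxPn (3 + m′) n) S → 7 ≤ n →
  ceil3 (n + 1) * (3 + m′ + 2) ∸ 2 ≤ card (KmxPn (3 + m′) n) S
lower-bound {m′} {n} S code 7≤n =
  subst (ceil3 (n + 1) * (3 + m′ + 2) ∸ 2 ≤_) (sym (card-by-column-counts S))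
    (columns-lower-bound (3 + m′) n (column-count S)
      (first-column-full S code (<-weaken 4 7≤n))
      (second-column-≥3 S code (<-weaken 5 7≤n))
      (penultimate-column-≥3 S code)
      (last-column-full S code)
      (window-sum S code)
      (last-window-sum S code)
      7≤n)

-- A sufficient local condition for a code

Excludes : ∀ {m} → (Fin m → Bool) → (Fin m → Bool) → Fin m → Set
Excludes near far i =
  (∃ λ k → k ≢ i × far k ≡ true) ⊎
  (∃₂ λ a b → b ≢ a × (a ≢ i × b ≢ i) × (near a ≡ true × near b ≡ true))

-- Why the vertex v in row i of the middle column y is separated from any other w: if v ∈ S, a w
-- in the left (right) column is excluded by a code neighbour of v on the far side, two columns
-- away from w, or by two code neighbours of v in the column of w; if v ∉ S, code neighbours on
-- both sides force w into the column of v, where the cover condition leaves only v itself.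
data Certificate {m} (x y z : Fin m → Bool) (i : Fin m) : Set where
  present : y i ≡ true → Excludes x z i → Excludes z x i → Certificate x y z i
  absent  : y i ≡ false → (∃ λ k → k ≢ i × x k ≡ true) → (∃ λ k → k ≢ i × z k ≡ true) →
            (∀ a → a ≢ i → x a ≡ true ⊎ z a ≡ true) → Certificate x y z i

module _ {m n : ℕ} where

  private
    _∈N_ : Fin m × Fin n → Fin m × Fin n → Set
    w ∈N v = _∈N[_] {KmxPn m n} w v

  ∈N-column-≤ : ∀ {a k b c} → (a , b) ∈N (k , c) → toℕ b ≤ suc (toℕ c)
  ∈N-column-≤ (inj₁ refl)             = n≤1+n _
  ∈N-column-≤ (inj₂ (_ , inj₁ c⋖b)) = ≤-reflexive (sym c⋖b)
  ∈N-column-≤ (inj₂ (_ , inj₂ b⋖c)) = ≤-trans (n≤1+n _) (≤-trans (≤-reflexive b⋖c) (n≤1+n _))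

  ∈N-column-≥ : ∀ {a k b c} → (a , b) ∈N (k , c) → toℕ c ≤ suc (toℕ b)
  ∈N-column-≥ (inj₁ refl)             = n≤1+n _
  ∈N-column-≥ (inj₂ (_ , inj₁ c⋖b)) = ≤-trans (n≤1+n _) (≤-trans (≤-reflexive c⋖b) (n≤1+n _))
  ∈N-column-≥ (inj₂ (_ , inj₂ b⋖c)) = ≤-reflexive (sym b⋖c)

  ∈N-same-column : ∀ {a k b c} → toℕ b ≡ toℕ c → (a , b) ∈N (k , c) → a ≡ k
  ∈N-same-column b≡c (inj₁ refl)             = refl
  ∈N-same-column b≡c (inj₂ (_ , inj₁ c⋖b)) = ⊥-elim (1+n≢n (trans c⋖b b≡c))
  ∈N-same-column b≡c (inj₂ (_ , inj₂ b⋖c)) = ⊥-elim (1+n≢n (trans b⋖c (sym b≡c)))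

  ∈N-same-row : ∀ {a b c} → (a , b) ∈N (a , c) → b ≡ c
  ∈N-same-row (inj₁ refl)          = refl
  ∈N-same-row (inj₂ (a≢a , _)) = ⊥-elim (a≢a refl)

module _ {m n : ℕ} (S : Fin m × Fin n → Bool) where

  private
    _∈N_ : Fin m × Fin n → Fin m × Fin n → Set
    w ∈N v = _∈N[_] {KmxPn m n} w v

  col-witness : ∀ t {k} → col S (suc t) k ≡ true → ∃ λ c → toℕ c ≡ t × S (k , c) ≡ true
  col-witness t x with t <? n
  ... | yes t<n = fromℕ< t<n , Fin.toℕ-fromℕ< t<n , x
  ... | no  _   = ⊥-elim (Bool.not-¬ x refl)

  col-left-witness : ∀ j {k} → col S (toℕ j) k ≡ true → ∃ λ c → Next c j × S (k , c) ≡ true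
  col-left-witness j x with toℕ j in j≡
  ... | zero  = ⊥-elim (Bool.not-¬ x refl)
  ... | suc t = let c , c≡t , S-kc = col-witness t x in c , cong suc c≡t , S-kc

  col-right-witness : ∀ j {k} → col S (2 + toℕ j) k ≡ true → ∃ λ c → Next j c × S (k , c) ≡ true
  col-right-witness j x = let c , c≡ , S-kc = col-witness (suc (toℕ j)) x in c , sym c≡ , S-kc

  module _ {i j a b} (covered : ∀ c → S c ≡ true → c ∈N (i , j) → (a , b) ∈N c) where

    private
      left-neighbour : ∀ {k} → k ≢ i → col S (toℕ j) k ≡ true → ∃ λ c → Next c j × (a , b) ∈N (k , c)
      left-neighbour k≢i x = let c , c⋖j , S-kc = col-left-witness j x in
        c , c⋖j , covered _ S-kc (inj₂ (≢-sym k≢i , inj₂ c⋖j))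

      right-neighbour : ∀ {k} → k ≢ i → col S (2 + toℕ j) k ≡ true → ∃ λ c → Next j c × (a , b) ∈N (k , c)
      right-neighbour k≢i z = let c , j⋖c , S-kc = col-right-witness j z in
        c , j⋖c , covered _ S-kc (inj₂ (≢-sym k≢i , inj₁ j⋖c))

      not-left : Excludes (col S (toℕ j)) (col S (2 + toℕ j)) i → ¬ Next b j
      not-left (inj₁ (k , k≢i , zk)) b⋖j =
        let c , j⋖c , w∈N = right-neighbour k≢i zk in
        1+n≰n (subst (_≤ suc (toℕ b)) (trans (sym j⋖c) (cong suc (sym b⋖j))) (∈N-column-≥ w∈N))
      not-left (inj₂ (a₁ , a₂ , a₂≢a₁ , (a₁≢i , a₂≢i) , (x₁ , x₂))) b⋖j = a₂≢a₁ (trans (sym (row-of a₂≢i x₂)) (row-of a₁≢i x₁))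
        where
        row-of : ∀ {k} → k ≢ i → col S (toℕ j) k ≡ true → a ≡ k
        row-of k≢i x = let c , c⋖j , w∈N = left-neighbour k≢i x in
          ∈N-same-column (suc-injective (trans b⋖j (sym c⋖j))) w∈N

      not-right : Excludes (col S (2 + toℕ j)) (col S (toℕ j)) i → ¬ Next j b
      not-right (inj₁ (k , k≢i , xk)) j⋖b =
        let c , c⋖j , w∈N = left-neighbour k≢i xk in
        1+n≰n (subst (_≤ suc (toℕ c)) (trans (sym j⋖b) (cong suc (sym c⋖j))) (∈N-column-≤ w∈N))
      not-right (inj₂ (a₁ , a₂ , a₂≢a₁ , (a₁≢i , a₂≢i) , (z₁ , z₂))) j⋖b = a₂≢a₁ (trans (sym (row-of a₂≢i z₂)) (row-of a₁≢i z₁))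
        where
        row-of : ∀ {k} → k ≢ i → col S (2 + toℕ j) k ≡ true → a ≡ k
        row-of k≢i z = let c , j⋖c , w∈N = right-neighbour k≢i z in
          ∈N-same-column (trans (sym j⋖b) j⋖c) w∈N

    identified : Certificate (col S (toℕ j)) (col S (suc (toℕ j))) (col S (2 + toℕ j)) i → (a , b) ≡ (i , j)
    identified (present yi left-excluded right-excluded) with covered (i , j) (trans (sym (col-suc-toℕ S j i)) yi) (inj₁ refl)
    ...   | inj₁ w≡v              = w≡v
    ...   | inj₂ (_ , inj₁ j⋖b) = ⊥-elim (not-right right-excluded j⋖b)
    ...   | inj₂ (_ , inj₂ b⋖j) = ⊥-elim (not-left left-excluded b⋖j)
    identified (absent _ (k₁ , k₁≢i , xk₁) (k₂ , k₂≢i , zk₂) cover) = cong₂ _,_ a≡i b≡j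
      where
      b≡j : b ≡ j
      b≡j = let c₁ , c₁⋖j , w∈N₁ = left-neighbour k₁≢i xk₁
                c₂ , j⋖c₂ , w∈N₂ = right-neighbour k₂≢i zk₂
            in Fin.toℕ-injective (≤-antisym (subst (toℕ b ≤_) c₁⋖j (∈N-column-≤ w∈N₁))
                                            (s≤s⁻¹ (subst (_≤ suc (toℕ b)) (sym j⋖c₂) (∈N-column-≥ w∈N₂))))
      same-column-as-j : ∀ {c} → (a , b) ∈N (a , c) → toℕ c ≡ toℕ j
      same-column-as-j w∈N = cong toℕ (trans (sym (∈N-same-row w∈N)) b≡j)
      a≡i : a ≡ i
      a≡i with a Fin.≟ i
      ... | yes a≡i = a≡i
      ... | no  a≢i = [ (λ x → let c , c⋖j , w∈N = left-neighbour a≢i x in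
                              ⊥-elim (1+n≢n (trans c⋖j (sym (same-column-as-j w∈N)))))
                      , (λ z → let c , j⋖c , w∈N = right-neighbour a≢i z in
                              ⊥-elim (1+n≢n (trans j⋖c (same-column-as-j w∈N)))) ]′ (cover a a≢i)

  code-from-certificates : (∃ λ c → S c ≡ true) →
    (∀ (j : Fin n) i → Certificate (col S (toℕ j)) (col S (suc (toℕ j))) (col S (2 + toℕ j)) i) →
    IsSIDCode (KmxPn m n) S
  code-from-certificates nonempty certificate = nonempty , dominating , λ (i , j) (a , b) →
    (λ covered → identified covered (certificate j i)) , λ { refl → covered-by-itself }
    where
    dominating : ∀ v → ∃ λ c → S c ≡ true × c ∈N v
    dominating (i , j) with certificate j i
    ... | present yi _ _ = (i , j) , trans (sym (col-suc-toℕ S j i)) yi , inj₁ refl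
    ... | absent _ (k , k≢i , xk) _ _ =
          let c , c⋖j , S-kc = col-left-witness j xk in (k , c) , S-kc , inj₂ (≢-sym k≢i , inj₂ c⋖j)
    covered-by-itself : ∀ {v} c → S c ≡ true → c ∈N v → v ∈N c
    covered-by-itself c _ (inj₁ refl)              = inj₁ refl
    covered-by-itself c _ (inj₂ (v≢c , inj₁ v⋖c)) = inj₂ (≢-sym v≢c , inj₂ v⋖c)
    covered-by-itself c _ (inj₂ (v≢c , inj₂ c⋖v)) = inj₂ (≢-sym v≢c , inj₁ c⋖v)

-- The construction

data Kind : Set where
  full row₀ rows₀₁ row₂ rows₁₂ rows₀₁₂ : Kind

member : Kind → ℕ → Bool
member full    _ = true
member row₀    0 = true
member rows₀₁  0 = true
member rows₀₁  1 = true
member row₂    2 = true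
member rows₁₂  1 = true
member rows₁₂  2 = true
member rows₀₁₂ 0 = true
member rows₀₁₂ 1 = true
member rows₀₁₂ 2 = true
member _       _ = false

data Phase : Set where
  φ₀ φ₁ φ₂ φ₃ φ₄ φ₅ : Phase

next : Phase → Phase
next φ₀ = φ₁
next φ₁ = φ₂
next φ₂ = φ₃
next φ₃ = φ₄
next φ₄ = φ₅
next φ₅ = φ₀

phase : ℕ → Phase
phase zero    = φ₀
phase (suc t) = next (phase t)

phase-kind : Phase → Kind
phase-kind φ₀ = full
phase-kind φ₁ = row₀
phase-kind φ₂ = rows₀₁
phase-kind φ₃ = full
phase-kind φ₄ = row₂
phase-kind φ₅ = rows₁₂

-- The column pattern of the construction: full, {0,1,2}, then periodically
-- {0,1}, full, {2}, {1,2}, full, {0}, and the last two columns full.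
inner : ℕ → Kind
inner 1 = rows₀₁₂
inner t = phase-kind (phase t)

kind : ℕ → ℕ → Kind
kind n t with n ≤? 2 + t
... | yes _ = full
... | no  _ = inner t

construction : ∀ m n → Fin m × Fin n → Bool
construction m n (i , j) = member (kind n (toℕ j)) (toℕ i)

Contains : ∀ {m} → Kind → (Fin m → Bool) → Set
Contains K x = ∀ k → member K (toℕ k) ≡ true → x k ≡ true

Is : ∀ {m} → Kind → (Fin m → Bool) → Set
Is K y = ∀ k → y k ≡ member K (toℕ k)

module _ {m′ : ℕ} where

  private
    r₀ r₁ r₂ : Fin (3 + m′)
    r₀ = zero
    r₁ = suc zero
    r₂ = suc (suc zero)

  present≢absent : ∀ {y : Fin (3 + m′) → Bool} {k i} → y k ≡ true → y i ≡ false → k ≢ i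
  present≢absent yk yi refl = Bool.not-¬ yk yi

  one-of-two : ∀ {a b : Fin (3 + m′)} → b ≢ a → ∀ i → ∃ λ k → (k ≡ a ⊎ k ≡ b) × k ≢ i
  one-of-two {a} {b} b≢a i with a Fin.≟ i
  ... | yes refl = b , inj₂ refl , b≢a
  ... | no  a≢i  = a , inj₁ refl , a≢i

  two-of-three : ∀ i → ∃₂ λ a b → b ≢ a × (a ≢ i × b ≢ i) × (member rows₀₁₂ (toℕ a) ≡ true × member rows₀₁₂ (toℕ b) ≡ true)
  two-of-three i with r₀ Fin.≟ i | r₁ Fin.≟ i
  ... | yes refl | _        = r₁ , r₂ , (λ ()) , ((λ ()) , (λ ())) , (refl , refl)
  ... | no 0≢i   | yes refl = r₀ , r₂ , (λ ()) , (0≢i , (λ ())) , (refl , refl)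
  ... | no 0≢i   | no 1≢i   = r₀ , r₁ , (λ ()) , (0≢i , 1≢i) , (refl , refl)

  module _ {x y z : Fin (3 + m′) → Bool} {i : Fin (3 + m′)} where

    certificate-left-full : (∀ k → x k ≡ true) → (y i ≡ false → ∃ λ k → k ≢ i × z k ≡ true) → Certificate x y z i
    certificate-left-full x-full right-witness with y i in yi
    ... | true  = let a , b , b≢a , (a≢i , b≢i) , _ = two-of-three i in
                  present yi (inj₂ (a , b , b≢a , (a≢i , b≢i) , (x-full a , x-full b))) (inj₁ (a , a≢i , x-full a))
    ... | false = let a , a≢i = avoid-one i in
                  absent yi (a , a≢i , x-full a) (right-witness refl) (λ a _ → inj₁ (x-full a))

    certificate-right-full : (∀ k → z k ≡ true) → (y i ≡ false → ∃ λ k → k ≢ i × x k ≡ true) → Certificate x y z i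
    certificate-right-full z-full left-witness with y i in yi
    ... | true  = let a , b , b≢a , (a≢i , b≢i) , _ = two-of-three i in
                  present yi (inj₁ (a , a≢i , z-full a)) (inj₂ (a , b , b≢a , (a≢i , b≢i) , (z-full a , z-full b)))
    ... | false = let a , a≢i = avoid-one i in
                  absent yi (left-witness refl) (a , a≢i , z-full a) (λ a _ → inj₂ (z-full a))

    first-certificate : (∀ k → x k ≡ false) → Is full y → Contains rows₀₁₂ z → Certificate x y z i
    first-certificate _ y-full z⊇ =
      let k , k∈ , k≢i = one-of-two {r₀} {r₁} (λ ()) i
          a , b , b≢a , (a≢i , b≢i) , (a∈ , b∈) = two-of-three i
      in present (y-full i) (inj₁ (k , k≢i , z⊇ k (in-rows₀₁ k∈)))
                          (inj₂ (a , b , b≢a , (a≢i , b≢i) , (z⊇ a a∈ , z⊇ b b∈)))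
      where
      in-rows₀₁ : ∀ {k} → k ≡ r₀ ⊎ k ≡ r₁ → member rows₀₁₂ (toℕ k) ≡ true
      in-rows₀₁ (inj₁ refl) = refl
      in-rows₀₁ (inj₂ refl) = refl

    inner-certificate : ∀ p → Contains (phase-kind p) x → Is (phase-kind (next p)) y →
      Contains (phase-kind (next (next p))) z → Certificate x y z i
    inner-certificate φ₀ x⊇ y≡ z⊇ = certificate-left-full (λ k → x⊇ k refl)
      λ yi → r₀ , present≢absent {y = y} (y≡ r₀) yi , z⊇ r₀ refl
    inner-certificate φ₁ x⊇ y≡ z⊇ = certificate-right-full (λ k → z⊇ k refl)
      λ yi → r₀ , present≢absent {y = y} (y≡ r₀) yi , x⊇ r₀ refl
    inner-certificate φ₂ x⊇ y≡ z⊇ = present (y≡ i) excludes-left excludes-right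
      where
      excludes-left : Excludes x z i
      excludes-left with r₂ Fin.≟ i
      ... | yes refl = inj₂ (r₀ , r₁ , (λ ()) , ((λ ()) , (λ ())) , (x⊇ r₀ refl , x⊇ r₁ refl))
      ... | no  2≢i  = inj₁ (r₂ , 2≢i , z⊇ r₂ refl)
      excludes-right : Excludes z x i
      excludes-right with one-of-two {r₀} {r₁} (λ ()) i
      ... | k , inj₁ refl , k≢i = inj₁ (k , k≢i , x⊇ k refl)
      ... | k , inj₂ refl , k≢i = inj₁ (k , k≢i , x⊇ k refl)
    inner-certificate φ₃ x⊇ y≡ z⊇ = certificate-left-full (λ k → x⊇ k refl)
      λ yi → r₂ , present≢absent {y = y} (y≡ r₂) yi , z⊇ r₂ refl
    inner-certificate φ₄ x⊇ y≡ z⊇ = certificate-right-full (λ k → z⊇ k refl)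
      λ yi → r₂ , present≢absent {y = y} (y≡ r₂) yi , x⊇ r₂ refl
    inner-certificate φ₅ x⊇ y≡ z⊇ = present (y≡ i) excludes-left excludes-right
      where
      excludes-left : Excludes x z i
      excludes-left with r₀ Fin.≟ i
      ... | yes refl = inj₂ (r₁ , r₂ , (λ ()) , ((λ ()) , (λ ())) , (x⊇ r₁ refl , x⊇ r₂ refl))
      ... | no  0≢i  = inj₁ (r₀ , 0≢i , z⊇ r₀ refl)
      excludes-right : Excludes z x i
      excludes-right with one-of-two {r₁} {r₂} (λ ()) i
      ... | k , inj₁ refl , k≢i = inj₁ (k , k≢i , x⊇ k refl)
      ... | k , inj₂ refl , k≢i = inj₁ (k , k≢i , x⊇ k refl)

module _ (m′ n : ℕ) where

  private
    S = construction (3 + m′) n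

  kind-full : ∀ {t} → n ≤ 2 + t → kind n t ≡ full
  kind-full {t} end with n ≤? 2 + t
  ... | yes _    = refl
  ... | no  ¬end = ⊥-elim (¬end end)

  kind-inner : ∀ {t} → ¬ (n ≤ 2 + t) → kind n t ≡ inner t
  kind-inner {t} ¬end with n ≤? 2 + t
  ... | yes end = ⊥-elim (¬end end)
  ... | no  _   = refl

  kind-⊇-inner : ∀ t r → member (inner t) r ≡ true → member (kind n t) r ≡ true
  kind-⊇-inner t r r∈ with n ≤? 2 + t
  ... | yes _ = refl
  ... | no  _ = r∈

  inner-⊇-phase : ∀ t r → member (phase-kind (phase t)) r ≡ true → member (inner t) r ≡ true
  inner-⊇-phase zero          r       r∈ = r∈
  inner-⊇-phase (suc zero)    zero    r∈ = refl
  inner-⊇-phase (suc (suc t)) r       r∈ = r∈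

  col-construction : ∀ {t} k → t < n → col S (suc t) k ≡ member (kind n t) (toℕ k)
  col-construction k t<n = trans (col-suc S k t<n) (cong (λ u → member (kind n u) (toℕ k)) (Fin.toℕ-fromℕ< t<n))

  col-⊇-phase : ∀ {t} → t < n → Contains (phase-kind (phase t)) (col S (suc t))
  col-⊇-phase {t} t<n k k∈ = trans (col-construction k t<n) (kind-⊇-inner t _ (inner-⊇-phase t _ k∈))

  col-is-inner : ∀ {t} → t < n → ¬ (n ≤ 2 + t) → Is (inner t) (col S (suc t))
  col-is-inner t<n ¬end k = trans (col-construction k t<n) (cong (λ K → member K (toℕ k)) (kind-inner ¬end))

  col-full-at-end : ∀ {t} → t < n → n ≤ 2 + t → ∀ k → col S (suc t) k ≡ true
  col-full-at-end t<n end k = trans (col-construction k t<n) (cong (λ K → member K (toℕ k)) (kind-full end))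

  certificate-at : 7 ≤ n → ∀ t → t < n → ∀ i → Certificate (col S t) (col S (suc t)) (col S (2 + t)) i
  certificate-at 7≤n zero _ i =
    first-certificate (λ _ → refl) (col-is-inner (<-weaken 6 7≤n) (<⇒≱ (<-weaken 4 7≤n)))
      (λ k k∈ → trans (col-construction k (<-weaken 5 7≤n)) (kind-⊇-inner 1 _ k∈))
  certificate-at 7≤n (suc zero) _ i =
    certificate-left-full (λ k → col-⊇-phase (<-weaken 6 7≤n) k refl)
      λ yi → zero , present≢absent {y = col S 2} (col-is-inner (<-weaken 5 7≤n) (<⇒≱ (<-weaken 3 7≤n)) zero) yi ,
             col-⊇-phase (<-weaken 4 7≤n) zero refl
  certificate-at 7≤n (suc (suc t)) 2+t<n i with n ≤? 4 + t
  ... | no ¬end = inner-certificate (phase (suc t)) (col-⊇-phase (<-weaken 1 2+t<n))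
                    (col-is-inner 2+t<n ¬end) (col-⊇-phase (<-weaken 1 (≰⇒> ¬end)))
  ... | yes end with n ≤? 3 + t
  ...   | yes last = certificate-left-full (col-full-at-end (<-weaken 1 2+t<n) last)
                       λ yi → ⊥-elim (Bool.not-¬ (col-full-at-end 2+t<n end i) yi)
  ...   | no ¬last = certificate-right-full (col-full-at-end (≰⇒> ¬last) (≤-trans end (n≤1+n _)))
                       λ yi → ⊥-elim (Bool.not-¬ (col-full-at-end 2+t<n end i) yi)

  construction-is-code : 7 ≤ n → IsSIDCode (KmxPn (3 + m′) n) S
  construction-is-code 7≤n = code-from-certificates S
    ((zero , fromℕ< 0<n) , trans (sym (col-suc S zero 0<n)) (col-⊇-phase 0<n zero refl))
    λ j i → certificate-at 7≤n (toℕ j) (Fin.toℕ<n j) i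
    where
    0<n : 0 < n
    0<n = <-weaken 6 7≤n

-- Upper bound

module _ (m n : ℕ) (c g : ℕ → ℕ)
  (c≤m    : ∀ t → c t ≤ m)
  (second : c 1 ≤ 3)
  (inner  : ∀ t → 5 + t ≤ n → c (2 + t) ≤ g (2 + t))
  (triple : ∀ t → g t + (g (1 + t) + g (2 + t)) ≤ m + 3)
  (after-triples : ∀ k → g (2 + k * 3) ≤ 2)
  where

  private
    h : ℕ → ℕ
    h t = c (2 + t)

    windows-≤ : ∀ k → 4 + k * 3 ≤ n → ∑< (k * 3) h ≤ k * (m + 3)
    windows-≤ k 4+3k≤n = begin
      ∑< (k * 3) h                                              ≡⟨ ∑<-triples k h ⟩
      ∑< k (λ p → h (p * 3) + (h (1 + p * 3) + h (2 + p * 3))) ≤⟨ ∑<-mono k triple-≤ ⟩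
      ∑< k (λ _ → m + 3)                                        ≡⟨ ∑<-const k (m + 3) ⟩
      k * (m + 3)                                               ∎
      where
      open ≤-Reasoning
      triple-≤ : ∀ p → p < k → h (p * 3) + (h (1 + p * 3) + h (2 + p * 3)) ≤ m + 3
      triple-≤ p p<k =
        let 7+3p≤n = ≤-trans (+-monoʳ-≤ 4 (*-monoˡ-≤ 3 p<k)) 4+3k≤n in
        ≤-trans (+-mono-≤ (inner _ (m+n≤o⇒n≤o 2 7+3p≤n)) (+-mono-≤ (inner _ (m+n≤o⇒n≤o 1 7+3p≤n)) (inner _ 7+3p≤n)))
                (triple (2 + p * 3))

    prefix-≤ : ∀ k b {T} → 4 + k * 3 ≤ n → ∑< b (λ t → h (t + k * 3)) ≤ T →
      ∑< (2 + (b + k * 3)) c ≤ m + (3 + (k * (m + 3) + T))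
    prefix-≤ k b {T} 4+3k≤n tail≤T = begin
      ∑< (2 + (b + k * 3)) c
        ≡⟨ split-columns c k b ⟩
      c 0 + (c 1 + (∑< (k * 3) h + ∑< b (λ t → h (t + k * 3))))
        ≤⟨ +-mono-≤ (c≤m 0) (+-mono-≤ second (+-mono-≤ (windows-≤ k 4+3k≤n) tail≤T)) ⟩
      m + (3 + (k * (m + 3) + T))
        ∎
      where open ≤-Reasoning

    column-after-triples : ∀ k → 5 + k * 3 ≤ n → h (k * 3) ≤ 2
    column-after-triples k bound = ≤-trans (inner (k * 3) bound) (after-triples k)

    bound-rem₀ : ∀ k → 4 + k * 3 ≡ n → ∑< n c ≤ (k + 2) * (m + 3) + m
    bound-rem₀ k n≡ = begin
      ∑< n c                                           ≡⟨ cong (λ s → ∑< s c) (sym n≡) ⟩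
      ∑< (4 + k * 3) c                                 ≤⟨ prefix-≤ k 2 (≤-reflexive n≡) tail ⟩
      m + (3 + (k * (m + 3) + (m + (m + 0))))          ≤⟨ m≤m+n _ 3 ⟩
      m + (3 + (k * (m + 3) + (m + (m + 0)))) + 3      ≡⟨ arithmetic k m ⟩
      (k + 2) * (m + 3) + m                            ∎
      where
      open ≤-Reasoning
      arithmetic : ∀ k m → m + (3 + (k * (m + 3) + (m + (m + 0)))) + 3 ≡ (k + 2) * (m + 3) + m
      arithmetic = solve-∀
      tail : ∑< 2 (λ t → h (t + k * 3)) ≤ m + (m + 0)
      tail = +-mono-≤ (c≤m _) (+-monoˡ-≤ 0 (c≤m _))

    bound-rem₁ : ∀ k → 5 + k * 3 ≡ n → ∑< n c ≤ (k + 2) * (m + 3) + m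
    bound-rem₁ k n≡ = begin
      ∑< n c                                           ≡⟨ cong (λ s → ∑< s c) (sym n≡) ⟩
      ∑< (5 + k * 3) c                                 ≤⟨ prefix-≤ k 3 (≤-trans (m≤n+m _ 1) (≤-reflexive n≡)) tail ⟩
      m + (3 + (k * (m + 3) + (2 + (m + (m + 0)))))    ≤⟨ m≤m+n _ 1 ⟩
      m + (3 + (k * (m + 3) + (2 + (m + (m + 0))))) + 1 ≡⟨ arithmetic k m ⟩
      (k + 2) * (m + 3) + m                            ∎
      where
      open ≤-Reasoning
      arithmetic : ∀ k m → m + (3 + (k * (m + 3) + (2 + (m + (m + 0))))) + 1 ≡ (k + 2) * (m + 3) + m
      arithmetic = solve-∀
      tail : ∑< 3 (λ t → h (t + k * 3)) ≤ 2 + (m + (m + 0))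
      tail = +-mono-≤ (column-after-triples k (≤-reflexive n≡)) (+-mono-≤ (c≤m _) (+-monoˡ-≤ 0 (c≤m _)))

    bound-rem₂ : ∀ k → 6 + k * 3 ≡ n → ∑< n c ≤ (k + 3) * (m + 3) + m
    bound-rem₂ k n≡ = begin
      ∑< n c                                                ≡⟨ cong (λ s → ∑< s c) (sym n≡) ⟩
      ∑< (6 + k * 3) c                                      ≤⟨ prefix-≤ k 4 (≤-trans (m≤n+m _ 2) (≤-reflexive n≡)) tail ⟩
      m + (3 + (k * (m + 3) + (2 + (m + (m + (m + 0))))))   ≤⟨ m≤m+n _ 4 ⟩
      m + (3 + (k * (m + 3) + (2 + (m + (m + (m + 0)))))) + 4 ≡⟨ arithmetic k m ⟩
      (k + 3) * (m + 3) + m                                 ∎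
      where
      open ≤-Reasoning
      arithmetic : ∀ k m → m + (3 + (k * (m + 3) + (2 + (m + (m + (m + 0)))))) + 4 ≡ (k + 3) * (m + 3) + m
      arithmetic = solve-∀
      tail : ∑< 4 (λ t → h (t + k * 3)) ≤ 2 + (m + (m + (m + 0)))
      tail = +-mono-≤ (column-after-triples k (≤-trans (m≤n+m _ 1) (≤-reflexive n≡)))
        (+-mono-≤ (c≤m _) (+-mono-≤ (c≤m _) (+-monoˡ-≤ 0 (c≤m _))))

    finish : ∀ {q} → ceil3 (n + 1) ≡ q → ∑< n c ≤ q * (m + 3) + m → ∑< n c ≤ ceil3 (n + 1) * (m + 3) + m
    finish ceil≡q bound = subst (λ q → ∑< n c ≤ q * (m + 3) + m) (sym ceil≡q) bound

  columns-upper-bound : 7 ≤ n → ∑< n c ≤ ceil3 (n + 1) * (m + 3) + m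
  columns-upper-bound 7≤n with m≤n⇒∃[o]m+o≡n (m+n≤o⇒m≤o 4 7≤n)
  ... | t , 4+t≡n with mod3 t
  ...   | rem₀ k = finish (ceil3-of k 0 4+t≡n) (bound-rem₀ k 4+t≡n)
  ...   | rem₁ k = finish (ceil3-of k 1 4+t≡n) (bound-rem₁ k 4+t≡n)
  ...   | rem₂ k = finish (ceil3-of k 2 4+t≡n) (bound-rem₂ k 4+t≡n)

phase-size : ℕ → Phase → ℕ
phase-size m φ₀ = m
phase-size m φ₁ = 1
phase-size m φ₂ = 2
phase-size m φ₃ = m
phase-size m φ₄ = 1
phase-size m φ₅ = 2

triple-size : ∀ m p → phase-size m p + (phase-size m (next p) + phase-size m (next (next p))) ≤ m + 3
triple-size m φ₀ = ≤-refl
triple-size m φ₁ = ≤-reflexive (+-comm 3 m)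
triple-size m φ₂ = ≤-reflexive (rotate m)
  where rotate : ∀ m → 2 + (m + 1) ≡ m + 3
        rotate = solve-∀
triple-size m φ₃ = ≤-refl
triple-size m φ₄ = ≤-reflexive (+-comm 3 m)
triple-size m φ₅ = ≤-reflexive (rotate m)
  where rotate : ∀ m → 2 + (m + 1) ≡ m + 3
        rotate = solve-∀

phase-of-multiple-of-3 : ∀ k → phase (k * 3) ≡ φ₀ ⊎ phase (k * 3) ≡ φ₃
phase-of-multiple-of-3 zero = inj₁ refl
phase-of-multiple-of-3 (suc k) with phase-of-multiple-of-3 k
... | inj₁ is-φ₀ = inj₂ (cong (next ∘ next ∘ next) is-φ₀)
... | inj₂ is-φ₃ = inj₁ (cong (next ∘ next ∘ next) is-φ₃)

size-after-triples : ∀ m k → phase-size m (phase (2 + k * 3)) ≤ 2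
size-after-triples m k with phase (k * 3) | phase-of-multiple-of-3 k
... | _ | inj₁ refl = ≤-refl
... | _ | inj₂ refl = ≤-refl

count-phase-kind : ∀ {m′} p → count (λ (k : Fin (3 + m′)) → member (phase-kind p) (toℕ k)) ≤ phase-size (3 + m′) p
count-phase-kind         φ₀ = count≤ (λ k → member full (toℕ k))
count-phase-kind {m′}    φ₁ = ≤-reflexive (cong (1 +_) (∑-zeros m′))
count-phase-kind {m′}    φ₂ = ≤-reflexive (cong (2 +_) (∑-zeros m′))
count-phase-kind         φ₃ = count≤ (λ k → member full (toℕ k))
count-phase-kind {m′}    φ₄ = ≤-reflexive (cong (1 +_) (∑-zeros m′))
count-phase-kind {m′}    φ₅ = ≤-reflexive (cong (2 +_) (∑-zeros m′))

module _ (m′ n : ℕ) (7≤n : 7 ≤ n) where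

  private
    m = 3 + m′
    S = construction m n

  second-column-count : column-count S 1 ≤ 3
  second-column-count = ≤-trans (≤-reflexive (count-cong (col-is-inner m′ n (<-weaken 5 7≤n) (<⇒≱ (<-weaken 3 7≤n)))))
    (≤-reflexive (cong (3 +_) (∑-zeros m′)))

  inner-column-count : ∀ t → 5 + t ≤ n → column-count S (2 + t) ≤ phase-size m (phase (2 + t))
  inner-column-count t 5+t≤n = ≤-trans (≤-reflexive (count-cong (col-is-inner m′ n (<-weaken 2 5+t≤n) (<⇒≱ 5+t≤n))))
    (count-phase-kind (phase (2 + t)))

  upper-bound : card (KmxPn m n) S ≤ ceil3 (n + 1) * (m + 3) + m
  upper-bound = subst (_≤ ceil3 (n + 1) * (m + 3) + m) (sym (card-by-column-counts S))
    (columns-upper-bound m n (column-count S) (phase-size m ∘ phase)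
      (λ t → count≤ (col S (suc t))) second-column-count inner-column-count
      (λ t → triple-size m (phase t)) (size-after-triples m) 7≤n)

theorem6 : (m n : ℕ) → 3 ≤ m → 7 ≤ n →
    ∃ λ γ → IsSIDNumber (KmxPn m n) γ ×
      (ceil3 (n + 1) * (m + 2) ∸ 2 ≤ γ) ×
      (γ ≤ ceil3 (n + 1) * (m + 3) + m)
theorem6 (suc (suc (suc m′))) n (s≤s (s≤s (s≤s _))) 7≤n =
  bounds (sidNumber-exists m n (construction m n) (construction-is-code m′ n 7≤n))
  where
  m : ℕ
  m = 3 + m′
  bounds : (∃ λ γ → IsSIDNumber (KmxPn m n) γ × γ ≤ card (KmxPn m n) (construction m n)) →
    ∃ λ γ → IsSIDNumber (KmxPn m n) γ × (ceil3 (n + 1) * (m + 2) ∸ 2 ≤ γ) × (γ ≤ ceil3 (n + 1) * (m + 3) + m)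
  bounds (γ , minimum@((S , code , |S|≡γ) , _) , γ≤|construction|) =
    γ , minimum ,
    subst (ceil3 (n + 1) * (m + 2) ∸ 2 ≤_) |S|≡γ (lower-bound S code 7≤n) ,
    ≤-trans γ≤|construction| (upper-bound m′ n 7≤n)
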